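{- For every integer $n\geq 1$, $$B_n(t)=CB_n(t)+\frac{1}{n}(1-t)\,CB_n'(t),$$ where $CB_n'(t)$ denotes the derivative of $CB_n(t)$ with respect to $t$, and $B_n,CB_n$ are as defined in the context.
   Context: For a permutation $\pi=[\pi_1,\dots,\pi_n]\in S_n$ (one-line notation), a (regular) bond is a pair $(\pi_i,\pi_{i+1})$ with $1\le i\le n-1$ and $\pi_i-\pi_{i+1}=\pm1$; $bnd(\pi)$ denotes the number of regular bonds of $\pi$. With the convention $\pi_{n+1}=\pi_1$, a cyclic bond is a pair $(\pi_i,\pi_{i+1})$ with $1\le i\le n$ and $\pi_i-\pi_{i+1}=\pm1$ (i.e. a regular bond, or the edge bond $(\pi_n,\pi_1)$ when $\pi_n-\pi_1=\pm1$); $cbnd(\pi)$ denotes the number of cyclic bonds of $\pi$. For $n=1$ the permutation $[1]$ has no cyclic bonds, and each of the two permutations of $S_2$ is regarded as having $2$ cyclic bonds. For $n\ge1$, $B_n(t)=\sum_{\pi\in S_n}t^{bnd(\pi)}$ and $CB_n(t)=\sum_{\pi\in S_n}t^{cbnd(\pi)}$. -}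

module Defs where

open import Data.Nat as ℕ using (ℕ; zero; suc)
open import Data.Fin using (Fin; toℕ)
open import Data.Fin.Properties using () renaming (_≟_ to _≟ᶠ_)
open import Data.List using (List; []; _∷_; [_]; map; concatMap; filter; foldr; replicate; _++_; allFin)
open import Data.Bool using (if_then_else_)
open import Data.Sum using (_⊎_)
open import Relation.Binary.PropositionalEquality using (_≡_)
open import Relation.Nullary.Decidable using (_⊎-dec_; does)
open import Data.Integer using (+_)
open import Data.Rational using (ℚ; 0ℚ; 1ℚ; _+_; _*_; _/_)
import Data.List.Relation.Unary.Unique.DecPropositional as UniqueDec

-- Permutations of S_n in one-line notation, as lists of entries in Fin n
-- (value i stands for i+1; bonds only depend on differences, so this shift
-- is harmless).

sequences : (n k : ℕ) → List (List (Fin n))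
sequences n zero    = [ [] ]
sequences n (suc k) = concatMap (λ i → map (i ∷_) (sequences n k)) (allFin n)

perms : (n : ℕ) → List (List (Fin n))
perms n = filter (UniqueDec.unique? _≟ᶠ_) (sequences n n)

Adj : ℕ → ℕ → Set
Adj a b = (suc a ≡ b) ⊎ (suc b ≡ a)

adjN : ℕ → ℕ → ℕ
adjN a b = if does ((suc a ℕ.≟ b) ⊎-dec (suc b ℕ.≟ a)) then 1 else 0

bndL : List ℕ → ℕ
bndL (a ∷ b ∷ xs) = adjN a b ℕ.+ bndL (b ∷ xs)
bndL _            = 0

lastOr : ℕ → List ℕ → ℕ
lastOr d []       = d
lastOr d (x ∷ xs) = lastOr x xs

-- number of cyclic bonds: regular bonds plus the edge bond (π_n, π_1)
-- (this gives 0 for n = 1 and 2 for both permutations of S_2, as required)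
cbndL : List ℕ → ℕ
cbndL []       = 0
cbndL (x ∷ xs) = bndL (x ∷ xs) ℕ.+ adjN (lastOr x xs) x

bnd : {n : ℕ} → List (Fin n) → ℕ
bnd π = bndL (map toℕ π)

cbnd : {n : ℕ} → List (Fin n) → ℕ
cbnd π = cbndL (map toℕ π)

-- Polynomials over ℚ as coefficient lists (index i = coefficient of t^i)
Poly : Set
Poly = List ℚ

_⊕_ : Poly → Poly → Poly
[]       ⊕ q        = q
p        ⊕ []       = p
(a ∷ p)  ⊕ (b ∷ q)  = (a + b) ∷ (p ⊕ q)

mono : ℕ → Poly
mono k = replicate k 0ℚ ++ [ 1ℚ ]

derivFrom : ℕ → Poly → Poly
derivFrom k []       = []
derivFrom k (c ∷ cs) = ((+ k / 1) * c) ∷ derivFrom (suc k) cs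

deriv : Poly → Poly
deriv []       = []
deriv (c ∷ cs) = derivFrom 1 cs

eval : Poly → ℚ → ℚ
eval p t = foldr (λ c acc → c + t * acc) 0ℚ p

B : ℕ → Poly
B n = foldr _⊕_ [] (map (λ π → mono (bnd π)) (perms n))

CB : ℕ → Poly
CB n = foldr _⊕_ [] (map (λ π → mono (cbnd π)) (perms n))

-- Write c(π) for the number of cyclic bonds and e(π) ∈ {0,1} for the edge bond (π_n, π_1), so that
-- bnd(π) = c(π) − e(π) and t^bnd(π) = t^c(π) + (1 − t) e(π) t^(c(π)−1).  Summing over S_n gives
-- B_n = CB_n + (1 − t) Σ_π e(π) t^(c(π)−1).  Rotation π ↦ [π_2, …, π_n, π_1] permutes S_n and preserves
-- c, and the edge bonds of the n rotations of π are exactly the n pairs (π_i, π_{i+1}) read cyclically,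
-- so Σ_{rotations σ of π} e(σ) = c(π).  Averaging over rotations turns n Σ_π e(π) t^(c(π)−1) into
-- Σ_π c(π) t^(c(π)−1) = CB_n'(t).
module Submission where

open import Defs
open import Data.Nat as ℕ using (ℕ; zero; suc; NonZero; _∸_)
import Data.Nat.Properties as ℕP
import Data.Nat.Coprimality as Coprimality
open import Data.Nat.ListAction using (sum)
open import Data.Integer as ℤ using (+_)
import Data.Integer.Properties as ℤP
open import Data.Rational using (ℚ; 0ℚ; 1ℚ; _+_; _*_; _-_; _/_; mkℚ; toℚᵘ; +-*-rawSemiring)
import Data.Rational.Properties as ℚP
import Data.Rational.Unnormalised as ℚᵘ
import Data.Rational.Unnormalised.Properties as ℚᵘP
open import Data.Rational.Solver using (module +-*-Solver)
open import Algebra.Definitions.RawSemiring +-*-rawSemiring using (_^_)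
open import Data.Fin using (Fin; toℕ)
open import Data.Fin.Properties using () renaming (_≟_ to _≟ᶠ_)
open import Data.List using (List; []; _∷_; [_]; _++_; map; concatMap; filter; foldr; iterate; length; allFin)
import Data.List.Properties as LP
open import Data.List.Relation.Unary.All as All using (All; []; _∷_)
import Data.List.Relation.Unary.All.Properties as AllP
import Data.List.Relation.Unary.Unique.DecPropositional as UniqueDec
import Data.List.Relation.Binary.Permutation.Setoid
import Data.List.Relation.Binary.Permutation.Setoid.Properties
open import Data.Bool using (true; false; if_then_else_)
open import Function using (_∘_)
open import Function.Bundles using (mk⇔)
open import Relation.Nullary.Decidable using (Dec; does; does-⇔; _⊎-dec_)
open import Relation.Unary using (Decidable)
open import Relation.Binary.PropositionalEquality hiding ([_])
open import Relation.Binary.PropositionalEquality.Properties using (setoid)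

open +-*-Solver

fromℕ : ℕ → ℚ
fromℕ k = + k / 1

fromℕ≡mkℚ : ∀ k → fromℕ k ≡ mkℚ (+ k) 0 (Coprimality.sym (Coprimality.1-coprimeTo k))
fromℕ≡mkℚ k = ℚP.normalize-coprime _

toℚᵘ-fromℕ : ∀ k → toℚᵘ (fromℕ k) ≡ ℚᵘ.mkℚᵘ (+ k) 0
toℚᵘ-fromℕ k = cong toℚᵘ (fromℕ≡mkℚ k)

fromℕ-+ : ∀ m k → fromℕ (m ℕ.+ k) ≡ fromℕ m + fromℕ k
fromℕ-+ m k = ℚP.toℚᵘ-injective (begin
  toℚᵘ (fromℕ (m ℕ.+ k))                ≡⟨ toℚᵘ-fromℕ (m ℕ.+ k) ⟩
  ℚᵘ.mkℚᵘ (+ (m ℕ.+ k)) 0               ≈⟨ ℚᵘ.*≡* pos-+-over-1 ⟩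
  ℚᵘ.mkℚᵘ (+ m) 0 ℚᵘ.+ ℚᵘ.mkℚᵘ (+ k) 0  ≡⟨ cong₂ ℚᵘ._+_ (toℚᵘ-fromℕ m) (toℚᵘ-fromℕ k) ⟨
  toℚᵘ (fromℕ m) ℚᵘ.+ toℚᵘ (fromℕ k)    ≈⟨ ℚP.toℚᵘ-homo-+ (fromℕ m) (fromℕ k) ⟨
  toℚᵘ (fromℕ m + fromℕ k)              ∎)
  where
  open ℚᵘP.≃-Reasoning
  pos-+-over-1 : + (m ℕ.+ k) ℤ.* + 1 ≡ (+ m ℤ.* + 1 ℤ.+ + k ℤ.* + 1) ℤ.* + 1
  pos-+-over-1 = trans (ℤP.*-identityʳ _) (trans (ℤP.pos-+ m k) (sym (trans (ℤP.*-identityʳ _)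
    (cong₂ ℤ._+_ (ℤP.*-identityʳ (+ m)) (ℤP.*-identityʳ (+ k))))))

1/n*n≡1 : ∀ n .{{_ : NonZero n}} → (+ 1 / n) * fromℕ n ≡ 1ℚ
-- normalised, + 1 / suc m is mkℚ (+ 1) m, which is by definition the reciprocal of mkℚ (+ suc m) 0
1/n*n≡1 (suc m) rewrite fromℕ≡mkℚ (suc m) | ℚP.normalize-coprime {1} {m} (Coprimality.1-coprimeTo (suc m)) =
  ℚP.*-inverseˡ (mkℚ (+ suc m) 0 (Coprimality.sym (Coprimality.1-coprimeTo (suc m))))

*-1/n*[*n] : ∀ n .{{_ : NonZero n}} a e → a * e ≡ (+ 1 / n) * (a * (fromℕ n * e))
*-1/n*[*n] n a e = begin
  a * e                            ≡⟨ ℚP.*-identityˡ (a * e) ⟨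
  1ℚ * (a * e)                     ≡⟨ cong (_* (a * e)) (1/n*n≡1 n) ⟨
  ((+ 1 / n) * fromℕ n) * (a * e)  ≡⟨ solve 4 (λ r m a e → (r :* m) :* (a :* e) := r :* (a :* (m :* e))) refl (+ 1 / n) (fromℕ n) a e ⟩
  (+ 1 / n) * (a * (fromℕ n * e))  ∎
  where open ≡-Reasoning

∑ : {A : Set} → List A → (A → ℚ) → ℚ
∑ []       f = 0ℚ
∑ (x ∷ xs) f = f x + ∑ xs f

infix 5 ∑
syntax ∑ xs (λ x → e) = ∑[ x ∈ xs ] e

module _ {A : Set} where

  ∑-cong : ∀ (xs : List A) {f g : A → ℚ} → (∀ x → f x ≡ g x) → ∑ xs f ≡ ∑ xs g
  ∑-cong []       f≗g = refl
  ∑-cong (x ∷ xs) f≗g = cong₂ _+_ (f≗g x) (∑-cong xs f≗g)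

  ∑-congᴬ : ∀ {xs : List A} {f g : A → ℚ} → All (λ x → f x ≡ g x) xs → ∑ xs f ≡ ∑ xs g
  ∑-congᴬ []           = refl
  ∑-congᴬ (fx≡gx ∷ eqs) = cong₂ _+_ fx≡gx (∑-congᴬ eqs)

  ∑-++ : ∀ (xs ys : List A) f → ∑ (xs ++ ys) f ≡ ∑ xs f + ∑ ys f
  ∑-++ []       ys f = sym (ℚP.+-identityˡ _)
  ∑-++ (x ∷ xs) ys f = trans (cong (_+_ (f x)) (∑-++ xs ys f)) (sym (ℚP.+-assoc (f x) _ _))

  ∑-zero : ∀ (xs : List A) → ∑[ x ∈ xs ] 0ℚ ≡ 0ℚ
  ∑-zero []       = refl
  ∑-zero (x ∷ xs) = trans (ℚP.+-identityˡ _) (∑-zero xs)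

  ∑-+ : ∀ (xs : List A) f g → ∑[ x ∈ xs ] (f x + g x) ≡ ∑ xs f + ∑ xs g
  ∑-+ []       f g = refl
  ∑-+ (x ∷ xs) f g rewrite ∑-+ xs f g =
    solve 4 (λ a b c d → (a :+ b) :+ (c :+ d) := (a :+ c) :+ (b :+ d)) refl (f x) (g x) (∑ xs f) (∑ xs g)

  ∑-*ˡ : ∀ c (xs : List A) f → ∑[ x ∈ xs ] (c * f x) ≡ c * ∑ xs f
  ∑-*ˡ c []       f = sym (ℚP.*-zeroʳ c)
  ∑-*ˡ c (x ∷ xs) f rewrite ∑-*ˡ c xs f = sym (ℚP.*-distribˡ-+ c (f x) (∑ xs f))

  ∑-fromℕ : ∀ xs (h : A → ℕ) → ∑[ x ∈ xs ] fromℕ (h x) ≡ fromℕ (sum (map h xs))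
  ∑-fromℕ []       h = refl
  ∑-fromℕ (x ∷ xs) h = trans (cong (_+_ (fromℕ (h x))) (∑-fromℕ xs h)) (sym (fromℕ-+ (h x) _))

  ∑-filter : ∀ {P : A → Set} (P? : Decidable P) xs (f : A → ℚ) →
             ∑ (filter P? xs) f ≡ ∑[ x ∈ xs ] (if does (P? x) then f x else 0ℚ)
  ∑-filter P? []       f = refl
  ∑-filter P? (x ∷ xs) f with does (P? x)
  ... | true  = cong (_+_ (f x)) (∑-filter P? xs f)
  ... | false = trans (∑-filter P? xs f) (sym (ℚP.+-identityˡ _))

module _ {A B : Set} where

  ∑-map : ∀ (h : A → B) xs (f : B → ℚ) → ∑ (map h xs) f ≡ ∑[ x ∈ xs ] f (h x)
  ∑-map h []       f = refl
  ∑-map h (x ∷ xs) f = cong (_+_ (f (h x))) (∑-map h xs f)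

  ∑-concatMap : ∀ (h : A → List B) xs (f : B → ℚ) → ∑ (concatMap h xs) f ≡ ∑[ x ∈ xs ] ∑ (h x) f
  ∑-concatMap h []       f = refl
  ∑-concatMap h (x ∷ xs) f =
    trans (∑-++ (h x) (concatMap h xs) f) (cong (_+_ (∑ (h x) f)) (∑-concatMap h xs f))

  ∑-comm : ∀ (xs : List A) (ys : List B) (f : A → B → ℚ) → ∑[ x ∈ xs ] ∑[ y ∈ ys ] f x y ≡ ∑[ y ∈ ys ] ∑[ x ∈ xs ] f x y
  ∑-comm []       ys f = sym (∑-zero ys)
  ∑-comm (x ∷ xs) ys f = trans (cong (_+_ (∑ ys (f x))) (∑-comm xs ys f)) (sym (∑-+ ys (f x) _))

eval-⊕ : ∀ p r t → eval (p ⊕ r) t ≡ eval p t + eval r t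
eval-⊕ []      r       t = sym (ℚP.+-identityˡ _)
eval-⊕ (a ∷ p) []      t = sym (ℚP.+-identityʳ _)
eval-⊕ (a ∷ p) (b ∷ r) t rewrite eval-⊕ p r t =
  solve 5 (λ a b t x y → (a :+ b) :+ t :* (x :+ y) := (a :+ t :* x) :+ (b :+ t :* y)) refl a b t (eval p t) (eval r t)

eval-mono : ∀ k t → eval (mono k) t ≡ t ^ k
eval-mono zero    t = trans (cong (_+_ 1ℚ) (ℚP.*-zeroʳ t)) (ℚP.+-identityʳ 1ℚ)
eval-mono (suc k) t = trans (ℚP.+-identityˡ _) (cong (t *_) (eval-mono k t))

⊕-identityʳ : ∀ p → p ⊕ [] ≡ p
⊕-identityʳ []      = refl
⊕-identityʳ (a ∷ p) = refl

derivFrom-⊕ : ∀ k p r → derivFrom k (p ⊕ r) ≡ derivFrom k p ⊕ derivFrom k r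
derivFrom-⊕ k []      r       = refl
derivFrom-⊕ k (a ∷ p) []      = refl
derivFrom-⊕ k (a ∷ p) (b ∷ r) = cong₂ _∷_ (ℚP.*-distribˡ-+ (fromℕ k) a b) (derivFrom-⊕ (suc k) p r)

deriv-⊕ : ∀ p r → deriv (p ⊕ r) ≡ deriv p ⊕ deriv r
deriv-⊕ []      r       = refl
deriv-⊕ (a ∷ p) []      = sym (⊕-identityʳ _)
deriv-⊕ (a ∷ p) (b ∷ r) = derivFrom-⊕ 1 p r

eval-derivFrom-mono : ∀ m k t → eval (derivFrom m (mono k)) t ≡ fromℕ (m ℕ.+ k) * t ^ k
eval-derivFrom-mono m zero    t rewrite ℕP.+-identityʳ m =
  solve 2 (λ a t → a :* con 1ℚ :+ t :* con 0ℚ := a :* con 1ℚ) refl (fromℕ m) t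
eval-derivFrom-mono m (suc k) t rewrite eval-derivFrom-mono (suc m) k t | ℕP.+-suc m k =
  solve 4 (λ a b t p → a :* con 0ℚ :+ t :* (b :* p) := b :* (t :* p)) refl (fromℕ m) (fromℕ (suc (m ℕ.+ k))) t (t ^ k)

eval-deriv-mono : ∀ k t → eval (deriv (mono k)) t ≡ fromℕ k * t ^ (k ∸ 1)
eval-deriv-mono zero    t = sym (ℚP.*-zeroˡ 1ℚ)
eval-deriv-mono (suc k) t = eval-derivFrom-mono 1 k t

genPoly : {A : Set} → (A → ℕ) → List A → Poly
genPoly g xs = foldr _⊕_ [] (map (λ x → mono (g x)) xs)

module _ {A : Set} (g : A → ℕ) (t : ℚ) where

  eval-genPoly : ∀ xs → eval (genPoly g xs) t ≡ ∑[ x ∈ xs ] t ^ g x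
  eval-genPoly []       = refl
  eval-genPoly (x ∷ xs) = trans (eval-⊕ (mono (g x)) _ t) (cong₂ _+_ (eval-mono (g x) t) (eval-genPoly xs))

  eval-deriv-genPoly : ∀ xs → eval (deriv (genPoly g xs)) t ≡ ∑[ x ∈ xs ] fromℕ (g x) * t ^ (g x ∸ 1)
  eval-deriv-genPoly []       = refl
  eval-deriv-genPoly (x ∷ xs) = begin
    eval (deriv (mono (g x) ⊕ genPoly g xs)) t               ≡⟨ cong (λ p → eval p t) (deriv-⊕ (mono (g x)) _) ⟩
    eval (deriv (mono (g x)) ⊕ deriv (genPoly g xs)) t        ≡⟨ eval-⊕ (deriv (mono (g x))) _ t ⟩
    eval (deriv (mono (g x))) t + eval (deriv (genPoly g xs)) t ≡⟨ cong₂ _+_ (eval-deriv-mono (g x) t) (eval-deriv-genPoly xs) ⟩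
    fromℕ (g x) * t ^ (g x ∸ 1) + (∑[ y ∈ xs ] fromℕ (g y) * t ^ (g y ∸ 1)) ∎
    where open ≡-Reasoning

module _ {A : Set} (f : A → A) where

  ∑-iterate : ∀ (xs : List A) → (∀ g → ∑[ x ∈ xs ] g (f x) ≡ ∑ xs g) →
              ∀ k g → ∑[ x ∈ xs ] ∑ (iterate f x k) g ≡ fromℕ k * ∑ xs g
  ∑-iterate xs ∑-f-invariant zero    g = trans (∑-zero xs) (sym (ℚP.*-zeroˡ (∑ xs g)))
  ∑-iterate xs ∑-f-invariant (suc k) g = begin
    ∑[ x ∈ xs ] (g x + ∑ (iterate f (f x) k) g)
      ≡⟨ ∑-+ xs g _ ⟩
    ∑ xs g + (∑[ x ∈ xs ] ∑ (iterate f (f x) k) g)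
      ≡⟨ cong (_+_ (∑ xs g)) (∑-f-invariant (λ x → ∑ (iterate f x k) g)) ⟩
    ∑ xs g + (∑[ x ∈ xs ] ∑ (iterate f x k) g)
      ≡⟨ cong (_+_ (∑ xs g)) (∑-iterate xs ∑-f-invariant k g) ⟩
    ∑ xs g + fromℕ k * ∑ xs g
      ≡⟨ solve 2 (λ s q → s :+ q :* s := (con 1ℚ :+ q) :* s) refl (∑ xs g) (fromℕ k) ⟩
    (1ℚ + fromℕ k) * ∑ xs g
      ≡⟨ cong (_* ∑ xs g) (fromℕ-+ 1 k) ⟨
    fromℕ (suc k) * ∑ xs g
      ∎
    where open ≡-Reasoning

  ∑-iterate-*-invariant : ∀ (c : A → ℚ) → (∀ x → c (f x) ≡ c x) →
                          ∀ a k x → ∑[ y ∈ iterate f x k ] (a y * c y) ≡ ∑ (iterate f x k) a * c x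
  ∑-iterate-*-invariant c c-invariant a zero    x = sym (ℚP.*-zeroˡ (c x))
  ∑-iterate-*-invariant c c-invariant a (suc k) x
    rewrite ∑-iterate-*-invariant c c-invariant a k (f x) | c-invariant x =
    sym (ℚP.*-distribʳ-+ (c x) (a x) _)

map-iterate : ∀ {A B : Set} {f : A → A} {f′ : B → B} (g : A → B) → (∀ x → g (f x) ≡ f′ (g x)) →
              ∀ x k → map g (iterate f x k) ≡ iterate f′ (g x) k
map-iterate g g∘f≗f′∘g x zero    = refl
map-iterate {f′ = f′} g g∘f≗f′∘g x (suc k) =
  cong (g x ∷_) (trans (map-iterate g g∘f≗f′∘g _ k) (cong (λ y → iterate f′ y k) (g∘f≗f′∘g x)))

rotate : {A : Set} → List A → List A
rotate []       = []
rotate (x ∷ xs) = xs ++ [ x ]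

map-rotate : ∀ {A B : Set} (g : A → B) xs → map g (rotate xs) ≡ rotate (map g xs)
map-rotate g []       = refl
map-rotate g (x ∷ xs) = LP.map-++ g xs [ x ]

ebndL : List ℕ → ℕ
ebndL []       = 0
ebndL (x ∷ xs) = adjN (lastOr x xs) x

ebnd : {n : ℕ} → List (Fin n) → ℕ
ebnd π = ebndL (map toℕ π)

cbndL≡bndL+ebndL : ∀ xs → cbndL xs ≡ bndL xs ℕ.+ ebndL xs
cbndL≡bndL+ebndL []       = refl
cbndL≡bndL+ebndL (x ∷ xs) = refl

adjN≤1 : ∀ a b → adjN a b ℕ.≤ 1
adjN≤1 a b with does ((suc a ℕ.≟ b) ⊎-dec (suc b ℕ.≟ a))
... | true  = ℕP.≤-refl
... | false = ℕ.z≤n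

ebndL≤1 : ∀ xs → ebndL xs ℕ.≤ 1
ebndL≤1 []       = ℕ.z≤n
ebndL≤1 (x ∷ xs) = adjN≤1 (lastOr x xs) x

lastOr-++-∷ : ∀ d xs a ys → lastOr d (xs ++ a ∷ ys) ≡ lastOr a ys
lastOr-++-∷ d []       a ys = refl
lastOr-++-∷ d (x ∷ xs) a ys = lastOr-++-∷ x xs a ys

bndL-∷ʳ : ∀ y ys x → bndL (y ∷ ys ++ [ x ]) ≡ bndL (y ∷ ys) ℕ.+ adjN (lastOr y ys) x
bndL-∷ʳ y []       x = ℕP.+-comm (adjN y x) 0
bndL-∷ʳ y (z ∷ zs) x rewrite bndL-∷ʳ z zs x = sym (ℕP.+-assoc (adjN y z) (bndL (z ∷ zs)) _)

cbndL-rotate : ∀ xs → cbndL (rotate xs) ≡ cbndL xs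
cbndL-rotate []           = refl
cbndL-rotate (x ∷ [])     = refl
cbndL-rotate (x ∷ y ∷ ys) rewrite bndL-∷ʳ y ys x | lastOr-++-∷ y ys x [] =
  trans (ℕP.+-comm _ (adjN x y)) (sym (ℕP.+-assoc (adjN x y) (bndL (y ∷ ys)) _))

-- The first rotation contributes the edge bond (last element, b); each later rotation starts at the
-- successor s′ of the previous starting element s and contributes the regular bond (s, s′).
sum-ebndL-rotations-++ : ∀ b bs a as →
  sum (map ebndL (iterate rotate ((b ∷ bs) ++ a ∷ as) (length (b ∷ bs)))) ≡ adjN (lastOr a as) b ℕ.+ bndL (b ∷ bs)
sum-ebndL-rotations-++ b []       a as = refl
sum-ebndL-rotations-++ b (c ∷ bs) a as
  rewrite lastOr-++-∷ c bs a as | LP.++-assoc bs (a ∷ as) [ b ]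
        | sum-ebndL-rotations-++ c bs a (as ++ [ b ]) | lastOr-++-∷ a as b [] = refl

sum-ebndL-rotations : ∀ xs → sum (map ebndL (iterate rotate xs (length xs))) ≡ cbndL xs
sum-ebndL-rotations []           = refl
sum-ebndL-rotations (x ∷ [])     = ℕP.+-comm (adjN x x) 0
sum-ebndL-rotations (x ∷ y ∷ ys) rewrite sum-ebndL-rotations-++ y ys x [] = ℕP.+-comm (ebndL (x ∷ y ∷ ys)) _

^-split : ∀ t b e → e ℕ.≤ 1 → t ^ b ≡ t ^ (b ℕ.+ e) + (1ℚ - t) * (fromℕ e * t ^ (b ℕ.+ e ∸ 1))
^-split t b zero    _ rewrite ℕP.+-identityʳ b =
  solve 3 (λ p t r → p := p :+ (con 1ℚ :- t) :* (con 0ℚ :* r)) refl (t ^ b) t (t ^ (b ∸ 1))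
^-split t b (suc zero) _ rewrite ℕP.+-comm b 1 =
  solve 2 (λ p t → p := t :* p :+ (con 1ℚ :- t) :* (con 1ℚ :* p)) refl (t ^ b) t
^-split t b (suc (suc e)) (ℕ.s≤s ())

^-bndL : ∀ t xs → t ^ bndL xs ≡ t ^ cbndL xs + (1ℚ - t) * (fromℕ (ebndL xs) * t ^ (cbndL xs ∸ 1))
^-bndL t xs rewrite cbndL≡bndL+ebndL xs = ^-split t (bndL xs) (ebndL xs) (ebndL≤1 xs)

module _ {n : ℕ} where

  private
    module ↭ = Data.List.Relation.Binary.Permutation.Setoid (setoid (Fin n))
    module ↭P = Data.List.Relation.Binary.Permutation.Setoid.Properties (setoid (Fin n))

  unique? : (xs : List (Fin n)) → Dec (UniqueDec.Unique _≟ᶠ_ xs)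
  unique? = UniqueDec.unique? _≟ᶠ_

  rotate-↭ : ∀ xs → rotate xs ↭.↭ xs
  rotate-↭ []       = ↭.↭-refl
  rotate-↭ (x ∷ xs) = ↭.↭-sym (↭P.∷↭∷ʳ x xs)

  unique?-rotate : ∀ xs → does (unique? (rotate xs)) ≡ does (unique? xs)
  unique?-rotate xs = does-⇔ (mk⇔ (↭P.Unique-resp-↭ (rotate-↭ xs)) (↭P.Unique-resp-↭ (↭.↭-sym (rotate-↭ xs))))
                             (unique? (rotate xs)) (unique? xs)

  ∑-sequences-∷ : ∀ k f → ∑ (sequences n (suc k)) f ≡ ∑[ i ∈ allFin n ] ∑[ s ∈ sequences n k ] f (i ∷ s)
  ∑-sequences-∷ k f = trans (∑-concatMap _ (allFin n) f) (∑-cong (allFin n) (λ i → ∑-map (i ∷_) (sequences n k) f))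

  ∑-sequences-∷ʳ : ∀ k f → ∑ (sequences n (suc k)) f ≡ ∑[ s ∈ sequences n k ] ∑[ i ∈ allFin n ] f (s ++ [ i ])
  ∑-sequences-∷ʳ zero    f = trans (∑-sequences-∷ zero f)
    (trans (∑-cong (allFin n) (λ i → ℚP.+-identityʳ (f [ i ]))) (sym (ℚP.+-identityʳ _)))
  ∑-sequences-∷ʳ (suc k) f = begin
    ∑ (sequences n (suc (suc k))) f
      ≡⟨ ∑-sequences-∷ (suc k) f ⟩
    ∑[ i ∈ allFin n ] ∑ (sequences n (suc k)) (λ s → f (i ∷ s))
      ≡⟨ ∑-cong (allFin n) (λ i → ∑-sequences-∷ʳ k (λ s → f (i ∷ s))) ⟩
    ∑[ i ∈ allFin n ] ∑[ s ∈ sequences n k ] ∑[ j ∈ allFin n ] f (i ∷ s ++ [ j ])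
      ≡⟨ ∑-sequences-∷ k (λ s → ∑[ j ∈ allFin n ] f (s ++ [ j ])) ⟨
    ∑[ s ∈ sequences n (suc k) ] ∑[ j ∈ allFin n ] f (s ++ [ j ])
      ∎
    where open ≡-Reasoning

  ∑-sequences-rotate : ∀ k f → ∑[ s ∈ sequences n k ] f (rotate s) ≡ ∑ (sequences n k) f
  ∑-sequences-rotate zero    f = refl
  ∑-sequences-rotate (suc k) f = begin
    ∑[ s ∈ sequences n (suc k) ] f (rotate s)                      ≡⟨ ∑-sequences-∷ k (f ∘ rotate) ⟩
    ∑[ i ∈ allFin n ] ∑[ s ∈ sequences n k ] f (s ++ [ i ])        ≡⟨ ∑-comm (allFin n) (sequences n k) (λ i s → f (s ++ [ i ])) ⟩
    ∑[ s ∈ sequences n k ] ∑[ i ∈ allFin n ] f (s ++ [ i ])        ≡⟨ ∑-sequences-∷ʳ k f ⟨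
    ∑ (sequences n (suc k)) f                                      ∎
    where open ≡-Reasoning

  ∑-perms-rotate : ∀ f → ∑[ π ∈ perms n ] f (rotate π) ≡ ∑ (perms n) f
  ∑-perms-rotate f = begin
    ∑ (filter unique? (sequences n n)) (f ∘ rotate)
      ≡⟨ ∑-filter unique? (sequences n n) (f ∘ rotate) ⟩
    ∑[ s ∈ sequences n n ] (if does (unique? s) then f (rotate s) else 0ℚ)
      ≡⟨ ∑-cong (sequences n n) (λ s → cong (λ b → if b then f (rotate s) else 0ℚ) (unique?-rotate s)) ⟨
    ∑[ s ∈ sequences n n ] restricted-f (rotate s)
      ≡⟨ ∑-sequences-rotate n restricted-f ⟩
    ∑ (sequences n n) restricted-f
      ≡⟨ ∑-filter unique? (sequences n n) f ⟨
    ∑ (filter unique? (sequences n n)) f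
      ∎
    where
    open ≡-Reasoning
    restricted-f : List (Fin n) → ℚ
    restricted-f s = if does (unique? s) then f s else 0ℚ

  sequences-length : ∀ k → All (λ s → length s ≡ k) (sequences n k)
  sequences-length zero    = refl ∷ []
  sequences-length (suc k) = AllP.concat⁺ (AllP.map⁺ (All.universal cons-length (allFin n)))
    where
    cons-length : ∀ i → All (λ s → length s ≡ suc k) (map (i ∷_) (sequences n k))
    cons-length i = AllP.map⁺ (All.map (cong suc) (sequences-length k))

  perms-length : All (λ π → length π ≡ n) (perms n)
  perms-length = AllP.filter⁺ unique? (sequences-length n)

cbnd-rotate : ∀ {n} (π : List (Fin n)) → cbnd (rotate π) ≡ cbnd π
cbnd-rotate π = trans (cong cbndL (map-rotate toℕ π)) (cbndL-rotate (map toℕ π))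

sum-ebnd-rotations : ∀ {n} (π : List (Fin n)) → sum (map ebnd (iterate rotate π (length π))) ≡ cbnd π
sum-ebnd-rotations π = begin
  sum (map (ebndL ∘ map toℕ) (iterate rotate π (length π)))
    ≡⟨ cong sum (LP.map-∘ (iterate rotate π (length π))) ⟩
  sum (map ebndL (map (map toℕ) (iterate rotate π (length π))))
    ≡⟨ cong (sum ∘ map ebndL) (map-iterate (map toℕ) (map-rotate toℕ) π (length π)) ⟩
  sum (map ebndL (iterate rotate (map toℕ π) (length π)))
    ≡⟨ cong (sum ∘ map ebndL ∘ iterate rotate (map toℕ π)) (LP.length-map toℕ π) ⟨
  sum (map ebndL (iterate rotate (map toℕ π) (length (map toℕ π))))
    ≡⟨ sum-ebndL-rotations (map toℕ π) ⟩
  cbnd π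
    ∎
  where open ≡-Reasoning

∑-ebnd-rotations : ∀ {n k} (w : ℕ → ℚ) (π : List (Fin n)) → length π ≡ k →
                   ∑[ σ ∈ iterate rotate π k ] (fromℕ (ebnd σ) * w (cbnd σ)) ≡ fromℕ (cbnd π) * w (cbnd π)
∑-ebnd-rotations w π refl = begin
  ∑[ σ ∈ rotations ] (fromℕ (ebnd σ) * w (cbnd σ))
    ≡⟨ ∑-iterate-*-invariant rotate (w ∘ cbnd) (cong w ∘ cbnd-rotate) (fromℕ ∘ ebnd) (length π) π ⟩
  (∑[ σ ∈ rotations ] fromℕ (ebnd σ)) * w (cbnd π)
    ≡⟨ cong (_* w (cbnd π)) (∑-fromℕ rotations ebnd) ⟩
  fromℕ (sum (map ebnd rotations)) * w (cbnd π)
    ≡⟨ cong (λ k → fromℕ k * w (cbnd π)) (sum-ebnd-rotations π) ⟩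
  fromℕ (cbnd π) * w (cbnd π)
    ∎
  where
  open ≡-Reasoning
  rotations : List (List (Fin _))
  rotations = iterate rotate π (length π)

ebnd-averaging : ∀ n (w : ℕ → ℚ) →
  fromℕ n * (∑[ π ∈ perms n ] (fromℕ (ebnd π) * w (cbnd π))) ≡ ∑[ π ∈ perms n ] (fromℕ (cbnd π) * w (cbnd π))
ebnd-averaging n w = begin
  fromℕ n * ∑ (perms n) weighted-ebnd
    ≡⟨ ∑-iterate rotate (perms n) ∑-perms-rotate n weighted-ebnd ⟨
  ∑[ π ∈ perms n ] ∑ (iterate rotate π n) weighted-ebnd
    ≡⟨ ∑-congᴬ (All.map (λ {π} → ∑-ebnd-rotations {k = n} w π) perms-length) ⟩
  ∑[ π ∈ perms n ] (fromℕ (cbnd π) * w (cbnd π))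
    ∎
  where
  open ≡-Reasoning
  weighted-ebnd : List (Fin n) → ℚ
  weighted-ebnd σ = fromℕ (ebnd σ) * w (cbnd σ)

theorem2p2 : (n : ℕ) → .{{_ : NonZero n}} → (t : ℚ) →
    eval (B n) t ≡ eval (CB n) t + ((+ 1 / n) * ((1ℚ - t) * eval (deriv (CB n)) t))
theorem2p2 n t = begin
  eval (B n) t
    ≡⟨ eval-genPoly bnd t (perms n) ⟩
  ∑[ π ∈ perms n ] t ^ bnd π
    ≡⟨ ∑-cong (perms n) (λ π → ^-bndL t (map toℕ π)) ⟩
  ∑[ π ∈ perms n ] (t ^ cbnd π + (1ℚ - t) * E π)
    ≡⟨ trans (∑-+ (perms n) _ _) (cong (_+_ C) (∑-*ˡ (1ℚ - t) (perms n) E)) ⟩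
  C + (1ℚ - t) * ∑ (perms n) E
    ≡⟨ cong (_+_ C) (*-1/n*[*n] n (1ℚ - t) (∑ (perms n) E)) ⟩
  C + (+ 1 / n) * ((1ℚ - t) * (fromℕ n * ∑ (perms n) E))
    ≡⟨ cong (λ s → C + (+ 1 / n) * ((1ℚ - t) * s)) (ebnd-averaging n (λ c → t ^ (c ∸ 1))) ⟩
  C + (+ 1 / n) * ((1ℚ - t) * D)
    ≡⟨ cong₂ (λ c d → c + (+ 1 / n) * ((1ℚ - t) * d)) (eval-genPoly cbnd t (perms n)) (eval-deriv-genPoly cbnd t (perms n)) ⟨
  eval (CB n) t + (+ 1 / n) * ((1ℚ - t) * eval (deriv (CB n)) t)
    ∎
  where
  open ≡-Reasoning
  C D : ℚ
  C = ∑[ π ∈ perms n ] t ^ cbnd π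
  D = ∑[ π ∈ perms n ] (fromℕ (cbnd π) * t ^ (cbnd π ∸ 1))
  E : List (Fin n) → ℚ
  E π = fromℕ (ebnd π) * t ^ (cbnd π ∸ 1)
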